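{- Let $\mathcal{B}$ be the class of all bipartite graphs. For every graph $H$, $c^{\mathcal{B}}_{\mathrm f}(H)\le 2$.
   Context: All graphs are finite and simple. For graphs $G,H$, a homomorphism $\varphi\colon G\to H$ is a map $V(G)\to V(H)$ with $\varphi(u)\varphi(v)\in E(H)$ whenever $uv\in E(G)$. $\dot\cup$ denotes vertex-disjoint union. For a graph class $\mathcal{G}$ and a graph $H$, a $\mathcal{G}$-cover of $H$ is an edge-surjective homomorphism $\varphi\colon G_1\dot\cup\cdots\dot\cup G_t\to H$ with all $G_i\in\mathcal{G}$; it is $s$-local if $|\varphi^{ -1}(v)|\le s$ for all $v\in V(H)$. $c^{\mathcal{G}}_{\mathrm f}(H)$ is the least $s$ such that $H$ has an $s$-local (not necessarily injective) $\mathcal{G}$-cover. -}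

module Defs where

open import Data.Nat using (ℕ; zero; suc; _+_; _≤_)
open import Data.Fin using (Fin; zero; suc)
open import Data.Fin.Properties using (_≟_)
open import Data.Bool using (Bool)
open import Data.Product using (Σ; ∃; ∃-syntax; _×_; _,_)
open import Relation.Nullary using (¬_; Dec; yes; no)
open import Relation.Binary.PropositionalEquality using (_≡_)
open import Level using (0ℓ)

record Graph : Set₁ where
  field
    n     : ℕ
    Adj   : Fin n → Fin n → Set
    adj?  : ∀ u v → Dec (Adj u v)
    sym   : ∀ {u v} → Adj u v → Adj v u
    irrefl : ∀ {u} → ¬ Adj u u

open Graph public

V : Graph → Set
V G = Fin (n G)

IsHom : (G H : Graph) → (V G → V H) → Set
IsHom G H φ = ∀ {u v} → Adj G u v → Adj H (φ u) (φ v)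

Bipartite : Graph → Set
Bipartite G = Σ (V G → Bool) λ c → ∀ {u v} → Adj G u v → ¬ (c u ≡ c v)

count : (m : ℕ) → (P : Fin m → Set) → (∀ i → Dec (P i)) → ℕ
count zero    P P? = 0
count (suc m) P P? with P? zero
... | yes _ = suc (count m (λ i → P (suc i)) (λ i → P? (suc i)))
... | no  _ = count m (λ i → P (suc i)) (λ i → P? (suc i))

sumFin : (t : ℕ) → (Fin t → ℕ) → ℕ
sumFin zero    f = 0
sumFin (suc t) f = f zero + sumFin t (λ i → f (suc i))

-- A 𝒢-cover of H (𝒢 given as a predicate on graphs): a family G_1,…,G_t of
-- graphs in 𝒢 and a homomorphism φ from their disjoint union to H (given
-- componentwise), which is edge-surjective.
record Cover (𝒢 : Graph → Set) (H : Graph) : Set₁ where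
  field
    t      : ℕ
    comp   : Fin t → Graph
    inClass : ∀ i → 𝒢 (comp i)
    φ      : (i : Fin t) → V (comp i) → V H
    hom    : ∀ i → IsHom (comp i) H (φ i)
    edgeSurj : ∀ {u v} → Adj H u v →
               ∃[ i ] ∃[ x ] ∃[ y ] (Adj (comp i) x y × φ i x ≡ u × φ i y ≡ v)

open Cover public

fibreSize : {𝒢 : Graph → Set} {H : Graph} → Cover 𝒢 H → V H → ℕ
fibreSize {H = H} C v =
  sumFin (t C) λ i → count (n (comp C i)) (λ x → φ C i x ≡ v) (λ x → φ C i x ≟ v)

IsLocal : {𝒢 : Graph → Set} {H : Graph} → ℕ → Cover 𝒢 H → Set
IsLocal s C = ∀ v → fibreSize C v ≤ s

HasLocalCover : (𝒢 : Graph → Set) → ℕ → Graph → Set₁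
HasLocalCover 𝒢 s H = Σ (Cover 𝒢 H) λ C → IsLocal s C

-- c^𝒢_f(H) ≤ k : the least s with an s-local 𝒢-cover is at most k,
-- i.e. some s ≤ k admits an s-local 𝒢-cover.
cf≤ : (𝒢 : Graph → Set) → Graph → ℕ → Set₁
cf≤ 𝒢 H k = Σ ℕ λ s → s ≤ k × HasLocalCover 𝒢 s H

{-# OPTIONS --safe #-}
-- The bipartite double cover H × K₂ (two copies of V(H), with u in one copy
-- adjacent to v in the other whenever uv ∈ E(H)) is bipartite, and projecting
-- it onto H is an edge-surjective homomorphism each of whose fibres consists
-- of the two copies of a vertex.
module Submission where

open import Defs
open import Data.Nat using (ℕ; zero; suc; _+_; _≤_; z≤n)
open import Data.Nat.Properties using (≤-refl; ≤-reflexive; ≤-trans; +-identityʳ; +-mono-≤)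
open import Data.Fin using (Fin; zero; suc; _↑ˡ_; _↑ʳ_; splitAt)
open import Data.Fin.Properties using (_≟_; 0≢1+n; suc-injective; splitAt-↑ˡ; splitAt-↑ʳ)
open import Data.Bool using (Bool; true; false)
open import Data.Bool.Properties using () renaming (_≟_ to _≟ᵇ_)
open import Data.Sum using ([_,_]′; reduce)
open import Data.Product using (∃-syntax; _×_; _,_; proj₁; proj₂; map)
open import Data.Empty using (⊥-elim)
open import Function using (_∘_; const)
open import Function.Definitions using (Injective)
open import Relation.Nullary using (¬_; yes; no; ¬?; _×-dec_)
open import Relation.Binary.PropositionalEquality
  using (_≡_; _≢_; refl; trans; cong; subst₂)
import Relation.Binary.PropositionalEquality as ≡

count≡0 : ∀ m (P : Fin m → Set) P? → (∀ i → ¬ P i) → count m P P? ≡ 0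
count≡0 zero    P P? none = refl
count≡0 (suc m) P P? none with P? zero
... | yes p = ⊥-elim (none zero p)
... | no  _ = count≡0 m (P ∘ suc) (P? ∘ suc) (none ∘ suc)

count≤1 : ∀ m (P : Fin m → Set) P? → (∀ i j → P i → P j → i ≡ j) →
          count m P P? ≤ 1
count≤1 zero    P P? unique = z≤n
count≤1 (suc m) P P? unique with P? zero
... | yes p = ≤-reflexive (cong suc (count≡0 m (P ∘ suc) (P? ∘ suc)
                (λ i q → 0≢1+n (unique zero (suc i) p q))))
... | no  _ = count≤1 m (P ∘ suc) (P? ∘ suc)
                (λ i j p q → suc-injective (unique (suc i) (suc j) p q))

count-+ : ∀ a b (P : Fin (a + b) → Set) P? →
          count (a + b) P P? ≡ count a (λ i → P (i ↑ˡ b)) (λ i → P? (i ↑ˡ b))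
                             + count b (λ i → P (a ↑ʳ i)) (λ i → P? (a ↑ʳ i))
count-+ zero    b P P? = refl
count-+ (suc a) b P P? with P? zero
... | yes _ = cong suc (count-+ a b (P ∘ suc) (P? ∘ suc))
... | no  _ = count-+ a b (P ∘ suc) (P? ∘ suc)

fibre : ∀ {m k} → (Fin m → Fin k) → Fin k → ℕ
fibre {m} f v = count m (λ x → f x ≡ v) (λ x → f x ≟ v)

fibre-+ : ∀ a b {k} (f : Fin (a + b) → Fin k) v →
          fibre f v ≡ fibre (f ∘ (_↑ˡ b)) v + fibre (f ∘ (a ↑ʳ_)) v
fibre-+ a b f v = count-+ a b (λ x → f x ≡ v) (λ x → f x ≟ v)

fibre-injective≤1 : ∀ {m k} {f : Fin m → Fin k} → Injective _≡_ _≡_ f →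
                    ∀ v → fibre f v ≤ 1
fibre-injective≤1 {m} f-inj v =
  count≤1 m _ _ (λ i j fi≡v fj≡v → f-inj (trans fi≡v (≡.sym fj≡v)))

EdgeSurjective : (G H : Graph) → (V G → V H) → Set
EdgeSurjective G H φ =
  ∀ {u v} → Adj H u v → ∃[ x ] ∃[ y ] (Adj G x y × φ x ≡ u × φ y ≡ v)

cf≤-single : ∀ {𝒢 H s} (G : Graph) → 𝒢 G → (φ : V G → V H) →
             IsHom G H φ → EdgeSurjective G H φ → (∀ v → fibre φ v ≤ s) →
             cf≤ 𝒢 H s
cf≤-single {𝒢} {H} {s} G G∈𝒢 φ φ-hom φ-surj φ-fibre = s , ≤-refl , cover , local
  where
  cover : Cover 𝒢 H
  cover = record
    { t        = 1
    ; comp     = const G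
    ; inClass  = const G∈𝒢
    ; φ        = const φ
    ; hom      = const φ-hom
    ; edgeSurj = λ e → zero , φ-surj e
    }

  local : IsLocal s cover
  local v = ≤-trans (≤-reflexive (+-identityʳ (fibre φ v))) (φ-fibre v)

module BipartiteDoubleCover (H : Graph) where

  base : Fin (n H + n H) → V H
  base = reduce ∘ splitAt (n H)

  side : Fin (n H + n H) → Bool
  side = [ const true , const false ]′ ∘ splitAt (n H)

  doubleCover : Graph
  doubleCover = record
    { n      = n H + n H
    ; Adj    = λ x y → Adj H (base x) (base y) × side x ≢ side y
    ; adj?   = λ x y → adj? H (base x) (base y) ×-dec ¬? (side x ≟ᵇ side y)
    ; sym    = map (Graph.sym H) (_∘ ≡.sym)
    ; irrefl = λ (_ , x≢x) → x≢x refl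
    }

  doubleCover-bipartite : Bipartite doubleCover
  doubleCover-bipartite = side , proj₂

  base-hom : IsHom doubleCover H base
  base-hom = proj₁

  base-↑ˡ : ∀ u → base (u ↑ˡ n H) ≡ u
  base-↑ˡ u = cong reduce (splitAt-↑ˡ (n H) u (n H))

  base-↑ʳ : ∀ v → base (n H ↑ʳ v) ≡ v
  base-↑ʳ v = cong reduce (splitAt-↑ʳ (n H) (n H) v)

  side-↑ˡ : ∀ u → side (u ↑ˡ n H) ≡ true
  side-↑ˡ u = cong [ const true , const false ]′ (splitAt-↑ˡ (n H) u (n H))

  side-↑ʳ : ∀ v → side (n H ↑ʳ v) ≡ false
  side-↑ʳ v = cong [ const true , const false ]′ (splitAt-↑ʳ (n H) (n H) v)

  base-edgeSurjective : EdgeSurjective doubleCover H base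
  base-edgeSurjective {u} {v} uv =
    u ↑ˡ n H , n H ↑ʳ v , (lifted-uv , sides-differ) , base-↑ˡ u , base-↑ʳ v
    where
    lifted-uv : Adj H (base (u ↑ˡ n H)) (base (n H ↑ʳ v))
    lifted-uv = subst₂ (Adj H) (≡.sym (base-↑ˡ u)) (≡.sym (base-↑ʳ v)) uv

    sides-differ : side (u ↑ˡ n H) ≢ side (n H ↑ʳ v)
    sides-differ rewrite side-↑ˡ u | side-↑ʳ v = λ ()

  base-fibre≤2 : ∀ v → fibre base v ≤ 2
  base-fibre≤2 v = ≤-trans (≤-reflexive (fibre-+ (n H) (n H) base v))
    (+-mono-≤ (fibre-injective≤1 (≗id⇒injective base-↑ˡ) v)
              (fibre-injective≤1 (≗id⇒injective base-↑ʳ) v))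
    where
    ≗id⇒injective : {f : V H → V H} → (∀ u → f u ≡ u) → Injective _≡_ _≡_ f
    ≗id⇒injective {f} f≗id {u} {w} fu≡fw =
      trans (≡.sym (f≗id u)) (trans fu≡fw (f≗id w))

lemma23 : (H : Graph) → cf≤ Bipartite H 2
lemma23 H = cf≤-single doubleCover doubleCover-bipartite base
                       base-hom base-edgeSurjective base-fibre≤2
  where open BipartiteDoubleCover H
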